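{- Let $\overline{\psi}$ and $\lambda$ be as defined in the context. There are no odd positive integers $n$ with $\lambda(n)=1$. Furthermore, if $x$ is an even positive integer with $\lambda(x)=m$, then $v_2(x)\neq m$.
   Context: Let $\overline{\psi}$ be the multiplicative arithmetic function with $\overline{\psi}(p^{\alpha})=p^{\alpha-1}(p+1)$ for odd primes $p$ and $\overline{\psi}(2^{\alpha})=2^{\alpha-1}$, for all positive integers $\alpha$ (so $\overline{\psi}(1)=1$). For $n>1$, $\lambda(n)$ is the unique nonnegative integer with $\overline{\psi}^{\lambda(n)}(n)=2$ (where $\overline{\psi}^k$ is the $k$-th iterate, $\overline{\psi}^0(n)=n$), and $\lambda(1)=0$. A positive integer $n$ is said to be in class $k$ if $\lambda(n)=k$. For a prime $p$ and positive integer $x$, $v_p(x)$ is the exponent of $p$ in the prime factorization of $x$. -}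

module Defs where

open import Data.Nat using (ℕ; zero; suc; _+_; _*_; _∸_; _^_; _<_; _/_)
open import Data.Nat.Divisibility using (_∣_; _∣?_)
open import Data.Nat.Primality using (prime?)
open import Data.Nat.ListAction using (product)
open import Data.List using (List; map; filter; upTo)
open import Data.Product using (_×_)
open import Data.Sum using (_⊎_)
open import Relation.Nullary using (yes; no)
open import Relation.Binary.PropositionalEquality using (_≡_)

-- p-adic valuation v_p(n), for p ≥ 2 and n ≥ 1 (fuel-bounded: v_p(n) ≤ n).
-- Conventions outside that range (irrelevant here): v_p(0) = 0, v_0 = v_1 = 0.
vAux : ℕ → ℕ → ℕ → ℕ
vAux zero    p n = 0
vAux (suc f) zero n = 0
vAux (suc f) (suc zero) n = 0
vAux (suc f) (suc (suc q)) zero = 0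
vAux (suc f) (suc (suc q)) (suc m) with suc (suc q) ∣? suc m
... | yes _ = suc (vAux f (suc (suc q)) (suc m / suc (suc q)))
... | no  _ = 0

v : ℕ → ℕ → ℕ
v p n = vAux n p n

psiPP : ℕ → ℕ → ℕ
psiPP p zero = 1
psiPP (suc (suc zero)) (suc a) = 2 ^ a
psiPP p (suc a) = p ^ a * (p + 1)

psibar : ℕ → ℕ
psibar n = product (map (λ p → psiPP p (v p n)) (filter prime? (upTo (suc n))))

iter : ℕ → ℕ → ℕ
iter zero    n = n
iter (suc k) n = psibar (iter k n)

-- λ(n) = k  (n positive): λ(1) = 0, and for n > 1, λ(n) is the k with ψ̄^k(n) = 2
-- (that k is unique, since ψ̄(2) = ψ̄(1) = 1).
InClass : ℕ → ℕ → Set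
InClass n k = (n ≡ 1 × k ≡ 0) ⊎ (1 < n × iter k n ≡ 2)

{-# OPTIONS --safe #-}
-- ψ̄ halves powers of two: ψ̄(2^(a+1)) = 2^a. If n is not a power of two it has an odd prime
-- factor r, and r + 1 ≥ 4 divides the odd-prime part of the product defining ψ̄(n). Hence an
-- odd n > 1 never has ψ̄(n) = 2; and if ψ̄(n) = 2^b, then r + 1 is a power of two, so
-- ψ̄(2^v₂(n)) · 4 ∣ 2^b and v₂(n) < b. As moreover v₂(n) ≤ v₂(ψ̄(n)) + 1, induction on k shows
-- that ψ̄^k(n) = 2 forces n = 2^(k+1) or v₂(n) < k; either way v₂(n) ≠ k.
module Submission where

open import Defs
open import Data.Nat using (ℕ; NonZero; zero; suc; _+_; _*_; _^_; _≤_; _<_; _/_; z≤n; s≤s; _≟_; _≤?_)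
open import Data.Nat.Base using (nonTrivial⇒n>1; ≢-nonZero⁻¹)
open import Data.Nat.Properties
  using (≤-refl; ≤-trans; ≤-antisym; ≤-pred; <-irrefl; <⇒≤; ≤⇒≯; ≰⇒>; >⇒≢; ≤∧≢⇒<; n≤1+n;
         1+n≢n; ^-monoʳ-<; *-comm; *-identityʳ; +-monoˡ-≤; ^-distribˡ-+-*; m^n>0; m^n≢0)
open import Data.Nat.Divisibility
  using (_∣_; divides; _∣?_; module ∣-Reasoning; ∣⇒≤; ∣-trans; ∣-refl; 1∣_; 0∣⇒≡0; m∣m*n; n∣m*n;
         ∣n⇒∣m*n; *-monoʳ-∣; *-cancelˡ-∣; m*n∣o⇒n∣o/m)
open import Data.Nat.DivMod using (m/n*n≡m; m/n<m; m≥n⇒m/n>0)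
open import Data.Nat.Logarithm using (⌊log₂_⌋; ⌊log₂[2^n]⌋≡n)
open import Data.Nat.Primality using (Prime; prime?; euclidsLemma; prime⇒nonTrivial)
open import Data.Nat.Primality.Factorisation using (factorise)
open import Data.Nat.ListAction using (product)
open import Data.Nat.ListAction.Properties using (∈⇒∣product)
open import Data.List using ([]; _∷_; map; filter; applyUpTo)
open import Data.List.Membership.Propositional using (_∈_)
open import Data.List.Membership.Propositional.Properties using (∈-map⁺; ∈-filter⁺; ∈-applyUpTo⁺; ∈-applyUpTo⁻)
open import Data.List.Relation.Unary.All using (All; []; _∷_)
open import Data.List.Relation.Unary.Any using (here; there)
open import Data.Product using (∃; _×_; _,_)
open import Data.Sum using (_⊎_; inj₁; inj₂)
open import Data.Empty using (⊥-elim)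
open import Function using (_∘_)
open import Relation.Nullary using (¬_; yes; no)
open import Relation.Unary using (Pred; Decidable)
open import Relation.Binary.PropositionalEquality
  using (_≡_; _≢_; refl; sym; trans; cong; cong₂; subst; module ≡-Reasoning)

prime>1 : ∀ {p} → Prime p → 1 < p
prime>1 {p} pr = nonTrivial⇒n>1 p {{prime⇒nonTrivial pr}}

^v∣ : ∀ {p} → 1 < p → ∀ n → p ^ v p n ∣ n
^v∣ {P@(suc (suc _))} (s≤s (s≤s z≤n)) n = go n n
  where
  go : ∀ fuel m → P ^ vAux fuel P m ∣ m
  go zero    m       = 1∣ m
  go (suc f) zero    = 1∣ 0
  go (suc f) (suc m) with P ∣? suc m
  ... | no  _   = 1∣ suc m
  ... | yes P∣m = begin
    P * P ^ vAux f P (suc m / P) ∣⟨ *-monoʳ-∣ P (go f (suc m / P)) ⟩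
    P * (suc m / P)              ≡⟨ *-comm P (suc m / P) ⟩
    suc m / P * P                ≡⟨ m/n*n≡m P∣m ⟩
    suc m                        ∎
    where open ∣-Reasoning

^∣⇒≤v : ∀ {p n j} → 1 < p → 0 < n → p ^ j ∣ n → j ≤ v p n
^∣⇒≤v {P@(suc (suc _))} {n} (s≤s (s≤s z≤n)) = go n n ≤-refl
  where
  go : ∀ fuel m {j} → m ≤ fuel → 0 < m → P ^ j ∣ m → j ≤ vAux fuel P m
  go _       _       {zero}  _          _ _       = z≤n
  go (suc f) (suc m) {suc j} (s≤s m≤f) _ P^1+j∣m with P ∣? suc m
  ... | no  P∤m = ⊥-elim (P∤m (∣-trans (m∣m*n (P ^ j)) P^1+j∣m))
  ... | yes P∣m = s≤s (go f (suc m / P) m/P≤f (m≥n⇒m/n>0 (∣⇒≤ P∣m)) (m*n∣o⇒n∣o/m P (P ^ j) P^1+j∣m))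
    where
    m/P≤f : suc m / P ≤ f
    m/P≤f = ≤-trans (≤-pred (m/n<m (suc m) P (s≤s (s≤s z≤n)))) m≤f

¬∣⇒v≡0 : ∀ {p n} → 1 < p → ¬ p ∣ n → v p n ≡ 0
¬∣⇒v≡0 {p} {n} 1<p p∤n with v p n | ^v∣ 1<p n
... | zero  | _        = refl
... | suc e | p^1+e∣n = ⊥-elim (p∤n (∣-trans (m∣m*n (p ^ e)) p^1+e∣n))

∣⇒v>0 : ∀ {p n} → Prime p → 0 < n → p ∣ n → 0 < v p n
∣⇒v>0 {p} {n} pr n>0 p∣n = ^∣⇒≤v (prime>1 pr) n>0 (subst (_∣ n) (sym (*-identityʳ p)) p∣n)

1<2^suc : ∀ a → 1 < 2 ^ suc a
1<2^suc a = ^-monoʳ-< 2 (s≤s (s≤s z≤n)) {0} {suc a} (s≤s z≤n)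

2^∣2^⇒≤ : ∀ a b → 2 ^ a ∣ 2 ^ b → a ≤ b
2^∣2^⇒≤ zero    b       _ = z≤n
2^∣2^⇒≤ (suc a) zero    d = ⊥-elim (≤⇒≯ (∣⇒≤ d) (1<2^suc a))
2^∣2^⇒≤ (suc a) (suc b) d = s≤s (2^∣2^⇒≤ a b (*-cancelˡ-∣ 2 d))

2^-injective : ∀ {a b} → 2 ^ a ≡ 2 ^ b → a ≡ b
2^-injective {a} {b} e = trans (sym (⌊log₂[2^n]⌋≡n a)) (trans (cong ⌊log₂_⌋ e) (⌊log₂[2^n]⌋≡n b))

v₂-2^ : ∀ a → v 2 (2 ^ a) ≡ a
v₂-2^ a = ≤-antisym (2^∣2^⇒≤ _ a (^v∣ 1<2 (2 ^ a))) (^∣⇒≤v 1<2 (m^n>0 2 a) ∣-refl)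
  where
  1<2 : 1 < 2
  1<2 = s≤s (s≤s z≤n)

prime∣2^⇒≡2 : ∀ {p} a → Prime p → p ∣ 2 ^ a → p ≡ 2
prime∣2^⇒≡2 zero    pr p∣1 = ⊥-elim (≤⇒≯ (∣⇒≤ p∣1) (prime>1 pr))
prime∣2^⇒≡2 (suc a) pr p∣2^1+a with euclidsLemma 2 (2 ^ a) pr p∣2^1+a
... | inj₁ p∣2   = ≤-antisym (∣⇒≤ p∣2) (prime>1 pr)
... | inj₂ p∣2^a = prime∣2^⇒≡2 a pr p∣2^a

product≡2^⊎oddPrime∈ : ∀ {as} → All Prime as → (∃ λ a → product as ≡ 2 ^ a) ⊎ (∃ λ r → Prime r × 2 < r × r ∈ as)
product≡2^⊎oddPrime∈ [] = inj₁ (0 , refl)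
product≡2^⊎oddPrime∈ {r ∷ _} (pr ∷ prs) with r ≟ 2 | product≡2^⊎oddPrime∈ prs
... | no r≢2   | _                             = inj₂ (r , pr , ≤∧≢⇒< (prime>1 pr) (r≢2 ∘ sym) , here refl)
... | yes refl | inj₁ (a , e)                  = inj₁ (suc a , cong (2 *_) e)
... | yes refl | inj₂ (r′ , pr′ , 2<r′ , r′∈) = inj₂ (r′ , pr′ , 2<r′ , there r′∈)

≡2^⊎oddPrime∣ : ∀ n .{{_ : NonZero n}} → (∃ λ a → n ≡ 2 ^ a) ⊎ (∃ λ r → Prime r × 2 < r × r ∣ n)
≡2^⊎oddPrime∣ n with record { isFactorisation = n≡∏ ; factorsPrime = prs } ← factorise n
                      with product≡2^⊎oddPrime∈ prs
... | inj₁ (a , e)              = inj₁ (a , trans n≡∏ e)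
... | inj₂ (r , pr , 2<r , r∈) = inj₂ (r , pr , 2<r , subst (r ∣_) (sym n≡∏) (∈⇒∣product r∈))

∣2^⇒≡2^ : ∀ {d} b → d ∣ 2 ^ b → ∃ λ c → d ≡ 2 ^ c
∣2^⇒≡2^ {zero}  b 0∣2^b = ⊥-elim (≢-nonZero⁻¹ (2 ^ b) {{m^n≢0 2 b}} (0∣⇒≡0 0∣2^b))
∣2^⇒≡2^ {suc d} b d∣2^b with ≡2^⊎oddPrime∣ (suc d)
... | inj₁ d≡2^c                = d≡2^c
... | inj₂ (r , pr , 2<r , r∣d) = ⊥-elim (>⇒≢ 2<r (prime∣2^⇒≡2 b pr (∣-trans r∣d d∣2^b)))

4≤2^⇒4∣2^ : ∀ c → 4 ≤ 2 ^ c → 4 ∣ 2 ^ c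
4≤2^⇒4∣2^ zero          (s≤s ())
4≤2^⇒4∣2^ (suc zero)    (s≤s (s≤s ()))
4≤2^⇒4∣2^ (suc (suc c)) _ = divides (2 ^ c) (trans (^-distribˡ-+-* 2 2 c) (*-comm 4 (2 ^ c)))

∣2^∧4≤⇒4∣ : ∀ {d} b → d ∣ 2 ^ b → 4 ≤ d → 4 ∣ d
∣2^∧4≤⇒4∣ b d∣2^b 4≤d with c , refl ← ∣2^⇒≡2^ b d∣2^b = 4≤2^⇒4∣2^ c 4≤d

2^*≡2^⇒≤ : ∀ f {R d b} → d ∣ R → 4 ≤ d → 2 ^ f * R ≡ 2 ^ b → 2 + f ≤ b
2^*≡2^⇒≤ f {R} {d} {b} d∣R 4≤d e = 2^∣2^⇒≤ (2 + f) b (begin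
  2 ^ (2 + f) ≡⟨ ^-distribˡ-+-* 2 2 f ⟩
  4 * 2 ^ f   ≡⟨ *-comm 4 (2 ^ f) ⟩
  2 ^ f * 4   ∣⟨ *-monoʳ-∣ (2 ^ f) (∣-trans 4∣d d∣R) ⟩
  2 ^ f * R   ≡⟨ e ⟩
  2 ^ b       ∎)
  where
  open ∣-Reasoning
  4∣d : 4 ∣ d
  4∣d = ∣2^∧4≤⇒4∣ b (∣-trans d∣R (subst (R ∣_) e (n∣m*n (2 ^ f)))) 4≤d

oddPrime∣odd : ∀ {n} → 1 < n → ¬ 2 ∣ n → ∃ λ r → Prime r × 2 < r × r ∣ n
oddPrime∣odd {n@(suc _)} 1<n 2∤n with ≡2^⊎oddPrime∣ n
... | inj₁ (zero  , n≡1)    = ⊥-elim (<-irrefl (sym n≡1) 1<n)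
... | inj₁ (suc a , n≡2^1+a) = ⊥-elim (2∤n (subst (2 ∣_) (sym n≡2^1+a) (m∣m*n (2 ^ a))))
... | inj₂ oddPrime         = oddPrime

psiFactor : ℕ → ℕ → ℕ
psiFactor n p = psiPP p (v p n)

-- For n = k + 2, ψ̄(n) unfolds by refl to ψ̄(2^v₂(n)) times oddFactors n k, the product over the
-- odd primes p ≤ n (psibar-split); the lemmas below use this unfolding silently.
oddFactors : ℕ → ℕ → ℕ
oddFactors n k = product (map (psiFactor n) (filter prime? (applyUpTo (3 +_) k)))

psibar-split : ∀ k → psibar (2 + k) ≡ psiPP 2 (v 2 (2 + k)) * oddFactors (2 + k) k
psibar-split k = refl

product-map-filter≡1 : ∀ {ℓ} {P : Pred ℕ ℓ} (P? : Decidable P) (f : ℕ → ℕ) xs →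
                       (∀ {x} → x ∈ xs → P x → f x ≡ 1) → product (map f (filter P? xs)) ≡ 1
product-map-filter≡1 P? f []       _ = refl
product-map-filter≡1 P? f (x ∷ xs) h with P? x
... | yes Px = cong₂ _*_ (h (here refl) Px) (product-map-filter≡1 P? f xs (h ∘ there))
... | no  _  = product-map-filter≡1 P? f xs (h ∘ there)

oddFactors≡1 : ∀ n k → (∀ {p} → Prime p → 2 < p → ¬ p ∣ n) → oddFactors n k ≡ 1
oddFactors≡1 n k oddPrime∤n = product-map-filter≡1 prime? (psiFactor n) (applyUpTo (3 +_) k) psiFactor≡1
  where
  psiFactor≡1 : ∀ {p} → p ∈ applyUpTo (3 +_) k → Prime p → psiFactor n p ≡ 1
  psiFactor≡1 p∈ pr with i , _ , refl ← ∈-applyUpTo⁻ (3 +_) p∈ =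
    cong (psiPP (3 + i)) (¬∣⇒v≡0 (prime>1 pr) (oddPrime∤n pr (s≤s (s≤s (s≤s z≤n)))))

psiFactor∣oddFactors : ∀ n k {p} → Prime p → 2 < p → p ≤ 2 + k → psiFactor n p ∣ oddFactors n k
psiFactor∣oddFactors n k {suc (suc (suc i))} pr (s≤s (s≤s (s≤s _))) (s≤s (s≤s i<k)) =
  ∈⇒∣product (∈-map⁺ (psiFactor n) (∈-filter⁺ prime? (∈-applyUpTo⁺ (3 +_) i<k) pr))

psiPP-odd∣ : ∀ {p m} → 2 < p → 0 < m → p + 1 ∣ psiPP p m
psiPP-odd∣ {p} {suc a} (s≤s (s≤s (s≤s _))) _ = n∣m*n (p ^ a)

oddPrime∣⇒+1∣oddFactors : ∀ {k r} → Prime r → 2 < r → r ∣ 2 + k → r + 1 ∣ oddFactors (2 + k) k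
oddPrime∣⇒+1∣oddFactors {k} pr 2<r r∣n =
  ∣-trans (psiPP-odd∣ 2<r (∣⇒v>0 pr (s≤s z≤n) r∣n)) (psiFactor∣oddFactors (2 + k) k pr 2<r (∣⇒≤ r∣n))

psibar-2^ : ∀ a → psibar (2 ^ suc a) ≡ 2 ^ a
psibar-2^ a = go (2 ^ suc a) (1<2^suc a) refl
  where
  go : ∀ n → 1 < n → n ≡ 2 ^ suc a → psibar n ≡ 2 ^ a
  go (suc (suc k)) (s≤s (s≤s _)) n≡2^1+a = begin
    psibar (2 + k)                                ≡⟨ psibar-split k ⟩
    psiPP 2 (v 2 (2 + k)) * oddFactors (2 + k) k ≡⟨ cong₂ _*_ (cong (psiPP 2) v₂n) (oddFactors≡1 (2 + k) k oddPrime∤n) ⟩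
    2 ^ a * 1                                     ≡⟨ *-identityʳ (2 ^ a) ⟩
    2 ^ a                                         ∎
    where
    open ≡-Reasoning
    v₂n : v 2 (2 + k) ≡ suc a
    v₂n = trans (cong (v 2) n≡2^1+a) (v₂-2^ (suc a))
    oddPrime∤n : ∀ {p} → Prime p → 2 < p → ¬ p ∣ 2 + k
    oddPrime∤n {p} pr 2<p p∣n = >⇒≢ 2<p (prime∣2^⇒≡2 (suc a) pr (subst (p ∣_) n≡2^1+a p∣n))

v₂≤1+v₂psibar : ∀ {n} → 1 < n → 0 < psibar n → v 2 n ≤ suc (v 2 (psibar n))
v₂≤1+v₂psibar {suc (suc k)} (s≤s (s≤s _)) ψn>0 with v 2 (2 + k) | m∣m*n {psiPP 2 (v 2 (2 + k))} (oddFactors (2 + k) k)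
... | zero  | _       = z≤n
... | suc f | 2^f∣ψn = s≤s (^∣⇒≤v (s≤s (s≤s z≤n)) ψn>0 2^f∣ψn)

psibar-odd≢2 : ∀ {n} → 1 < n → ¬ 2 ∣ n → psibar n ≢ 2
psibar-odd≢2 {suc (suc k)} 1<n 2∤n ψn≡2 with r , pr , 2<r , r∣n ← oddPrime∣odd 1<n 2∤n =
  ≤⇒≯ (∣⇒≤ r+1∣2) (≤-trans (n≤1+n 3) (+-monoˡ-≤ 1 2<r))
  where
  r+1∣2 : r + 1 ∣ 2
  r+1∣2 = subst (r + 1 ∣_) ψn≡2 (∣n⇒∣m*n (psiPP 2 (v 2 (2 + k))) (oddPrime∣⇒+1∣oddFactors {k} pr 2<r r∣n))

psiPP2*≡2^⇒< : ∀ f {R d b} → d ∣ R → 4 ≤ d → psiPP 2 f * R ≡ 2 ^ b → f < b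
psiPP2*≡2^⇒< zero    d∣R 4≤d e = ≤-trans (n≤1+n 1) (2^*≡2^⇒≤ 0 d∣R 4≤d e)
psiPP2*≡2^⇒< (suc f) d∣R 4≤d e = 2^*≡2^⇒≤ f d∣R 4≤d e

oddPrime∣∧psibar≡2^⇒v₂< : ∀ {n r b} → 1 < n → Prime r → 2 < r → r ∣ n → psibar n ≡ 2 ^ b → v 2 n < b
oddPrime∣∧psibar≡2^⇒v₂< {suc (suc k)} (s≤s (s≤s _)) pr 2<r r∣n =
  psiPP2*≡2^⇒< (v 2 (2 + k)) (oddPrime∣⇒+1∣oddFactors pr 2<r r∣n) (+-monoˡ-≤ 1 2<r)

psibar≡2^⇒≡2^⊎v₂< : ∀ {n k} → 1 < n → psibar n ≡ 2 ^ suc k → n ≡ 2 ^ suc (suc k) ⊎ v 2 n < suc k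
psibar≡2^⇒≡2^⊎v₂< {n@(suc _)} {k} 1<n ψn≡2^1+k with ≡2^⊎oddPrime∣ n
... | inj₁ (zero  , n≡1)          = ⊥-elim (<-irrefl (sym n≡1) 1<n)
... | inj₁ (suc a , n≡2^1+a)      = inj₁ (trans n≡2^1+a (cong (λ c → 2 ^ suc c) a≡1+k))
  where
  a≡1+k : a ≡ suc k
  a≡1+k = 2^-injective (trans (sym (psibar-2^ a)) (trans (cong psibar (sym n≡2^1+a)) ψn≡2^1+k))
... | inj₂ (r , pr , 2<r , r∣n) = inj₂ (oddPrime∣∧psibar≡2^⇒v₂< 1<n pr 2<r r∣n ψn≡2^1+k)

iter-suc : ∀ k n → iter (suc k) n ≡ iter k (psibar n)
iter-suc zero    n = refl
iter-suc (suc k) n = cong psibar (iter-suc k n)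

psibar≤1 : ∀ {n} → n ≤ 1 → psibar n ≤ 1
psibar≤1 z≤n       = ≤-refl
psibar≤1 (s≤s z≤n) = ≤-refl

iter≤1 : ∀ k {n} → n ≤ 1 → iter k n ≤ 1
iter≤1 zero    n≤1 = n≤1
iter≤1 (suc k) n≤1 = psibar≤1 (iter≤1 k n≤1)

iter≡2⇒1< : ∀ k {n} → iter k n ≡ 2 → 1 < n
iter≡2⇒1< k {n} e with n ≤? 1
... | yes n≤1 = ⊥-elim (≤⇒≯ (subst (_≤ 1) e (iter≤1 k n≤1)) ≤-refl)
... | no  n≰1 = ≰⇒> n≰1

iter≡2⇒≡2^⊎v₂< : ∀ k {n} → iter k n ≡ 2 → n ≡ 2 ^ suc k ⊎ v 2 n < k
iter≡2⇒≡2^⊎v₂< zero    e = inj₁ e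
iter≡2⇒≡2^⊎v₂< (suc k) {n} e = lift (iter≡2⇒≡2^⊎v₂< k ψe)
  where
  ψe : iter k (psibar n) ≡ 2
  ψe = trans (sym (iter-suc k n)) e
  1<n : 1 < n
  1<n = iter≡2⇒1< (suc k) e
  lift : psibar n ≡ 2 ^ suc k ⊎ v 2 (psibar n) < k → n ≡ 2 ^ suc (suc k) ⊎ v 2 n < suc k
  lift (inj₁ ψn≡2^1+k) = psibar≡2^⇒≡2^⊎v₂< 1<n ψn≡2^1+k
  lift (inj₂ v₂ψn<k)  = inj₂ (s≤s (≤-trans (v₂≤1+v₂psibar 1<n (<⇒≤ (iter≡2⇒1< k ψe))) v₂ψn<k))

lemma2p2 : ((n : ℕ) → 0 < n → ¬ (2 ∣ n) → ¬ InClass n 1)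
             × ((x m : ℕ) → 0 < x → 2 ∣ x → InClass x m → v 2 x ≢ m)
lemma2p2 = noOddInClass1 , v₂≢class
  where
  noOddInClass1 : (n : ℕ) → 0 < n → ¬ (2 ∣ n) → ¬ InClass n 1
  noOddInClass1 n _ _   (inj₁ (_ , ()))
  noOddInClass1 n _ 2∤n (inj₂ (1<n , ψn≡2)) = psibar-odd≢2 1<n 2∤n ψn≡2
  v₂≢class : (x m : ℕ) → 0 < x → 2 ∣ x → InClass x m → v 2 x ≢ m
  v₂≢class x m _ 2∣1 (inj₁ (refl , _)) _ = ≤⇒≯ (∣⇒≤ 2∣1) ≤-refl
  v₂≢class x m _ _   (inj₂ (_ , e)) v₂x≡m with iter≡2⇒≡2^⊎v₂< m e
  ... | inj₁ x≡2^1+m = 1+n≢n (trans (sym (trans (cong (v 2) x≡2^1+m) (v₂-2^ (suc m)))) v₂x≡m)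
  ... | inj₂ v₂x<m   = <-irrefl v₂x≡m v₂x<m
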